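{- There exists a nondecreasing computable function $g$ such that $\sum_i 2^{ -g(i)}=\infty$ and such that for every increasing sequence of positive integers $(t_i)$, $$\sum_i 2^{ -g(t_i)}=\infty \;\Longrightarrow\; \sum_i 2^{t_i-t_{i+1}}=\infty.$$ -}

module Defs where

open import Data.Nat using (ℕ; zero; suc; _≤_; _<_; _∸_)
open import Data.Rational using (ℚ; 0ℚ; 1ℚ; ½; _+_; _*_) renaming (_<_ to _<ℚ_)
open import Data.Product using (∃-syntax)

pow2neg : ℕ → ℚ
pow2neg zero    = 1ℚ
pow2neg (suc k) = ½ * pow2neg k

partialSum : (ℕ → ℚ) → ℕ → ℚ
partialSum a zero    = 0ℚ
partialSum a (suc n) = partialSum a n + a n

Diverges : (ℕ → ℚ) → Set
Diverges a = ∀ (B : ℚ) → ∃[ N ] (B <ℚ partialSum a N)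

Nondecreasing : (ℕ → ℕ) → Set
Nondecreasing g = ∀ {m n} → m ≤ n → g m ≤ g n

StrictlyIncreasing : (ℕ → ℕ) → Set
StrictlyIncreasing t = ∀ i → t i < t (suc i)

Positive : (ℕ → ℕ) → Set
Positive t = ∀ i → 0 < t i

-- g equals 2^j on the j-th block of 2^(2^j) consecutive indices, so every block contributes 1
-- to the series of 2^(-g), which therefore diverges.  For the implication, let the potential W be
-- the partial sums of the weight 2^(-(j + 2^j)) on block j, plus a bonus 2^(-2^j) on the last index
-- of the block.  Block j carries 2^(-j) + 2^(-2^j) in total, so W is bounded; and within g(t)
-- steps of any t, W grows by at least 2^(-g(t)).  Hence 2^(-g(t)) + W(t) ≤ 2^(-(s-t)) + W(s) for
-- all t ≤ s, and telescoping along (t_i) bounds the partial sums of 2^(-g(t_i)) by those of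
-- 2^(t_i - t_(i+1)) plus sup W.
{-# OPTIONS --safe #-}
module Submission where

open import Defs
open import Data.Nat using (ℕ; suc; _∸_)
open import Data.Product using (∃-syntax; _×_)

open import Data.Nat as ℕ using (zero; _^_; _<?_; _≤?_; _≤′_; ≤′-refl; ≤′-step)
import Data.Nat.Properties as ℕₚ
open import Data.Integer as ℤ using (-[1+_]; -<+)
import Data.Integer.Properties as ℤₚ
open import Data.Rational as ℚ using (ℚ; mkℚ; 0ℚ; 1ℚ; ½; -_; _+_; _≤_; _<_; *<*)
open import Data.Rational.Literals using (fromℤ)
import Data.Rational.Properties as ℚₚ
open import Data.Rational.Solver using (module +-*-Solver)
open import Algebra.Properties.Monoid.Mult ℚₚ.+-0-monoid
  using (×-homo-+; ×-assocˡ) renaming (_×_ to _·_)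
open import Data.Product using (_,_; proj₁; proj₂)
open import Function using (_∘_)
open import Relation.Binary.Core using (Rel)
open import Relation.Binary.Structures using (IsPreorder)
import Relation.Binary.Construct.Flip.EqAndOrd as Flip
open import Relation.Binary.PropositionalEquality
open import Relation.Nullary using (yes; no; contradiction)

module _ {a ℓ₁ ℓ₂} {A : Set a} {_≈_ : Rel A ℓ₁} {_≲_ : Rel A ℓ₂}
         (≲-isPreorder : IsPreorder _≈_ _≲_) where
  open IsPreorder ≲-isPreorder using () renaming (refl to ≲-refl; trans to ≲-trans)

  suc-mono⇒mono : (f : ℕ → A) → (∀ n → f n ≲ f (suc n)) →
                  ∀ {m n} → m ℕ.≤ n → f m ≲ f n
  suc-mono⇒mono f f-suc {m} m≤n = go (ℕₚ.≤⇒≤′ m≤n)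
    where
    go : ∀ {n} → m ≤′ n → f m ≲ f n
    go ≤′-refl        = ≲-refl
    go (≤′-step m≤′n) = ≲-trans (go m≤′n) (f-suc _)

p≤p+q : ∀ p {q} → 0ℚ ≤ q → p ≤ p + q
p≤p+q p 0≤q = subst (_≤ p + _) (ℚₚ.+-identityʳ p) (ℚₚ.+-monoʳ-≤ p 0≤q)

p≤q+p : ∀ p {q} → 0ℚ ≤ q → p ≤ q + p
p≤q+p p {q} 0≤q = subst (p ≤_) (ℚₚ.+-comm p q) (p≤p+q p 0≤q)

+-cancelʳ-< : ∀ {p q} r → p + r < q + r → p < q
+-cancelʳ-< {p} {q} r p+r<q+r =
  subst₂ _<_ (cancel p) (cancel q) (ℚₚ.+-monoˡ-< (- r) p+r<q+r)
  where
  open +-*-Solver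
  cancel : ∀ x → x + r + - r ≡ x
  cancel x = solve 2 (λ x r → x :+ r :+ :- r := x) refl x r

·-monoˡ-≤ : ∀ {x} → 0ℚ ≤ x → ∀ {m n} → m ℕ.≤ n → m · x ≤ n · x
·-monoˡ-≤ {x} 0≤x = suc-mono⇒mono ℚₚ.≤-isPreorder (_· x) (λ m → p≤q+p (m · x) 0≤x)

0≤n·x : ∀ {x} → 0ℚ ≤ x → ∀ n → 0ℚ ≤ n · x
0≤n·x 0≤x n = ·-monoˡ-≤ 0≤x {0} {n} ℕ.z≤n

n<2^n : ∀ n → n ℕ.< 2 ^ n
n<2^n zero    = ℕ.s≤s ℕ.z≤n
n<2^n (suc n) =
  ℕₚ.+-mono-≤ (ℕₚ.m^n>0 2 n) (subst (suc n ℕ.≤_) (sym (ℕₚ.+-identityʳ _)) (n<2^n n))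

0≤pow2neg : ∀ k → 0ℚ ≤ pow2neg k
0≤pow2neg zero    = ℚₚ.nonNegative⁻¹ 1ℚ
0≤pow2neg (suc k) = ℚₚ.*-monoˡ-≤-nonNeg ½ (0≤pow2neg k)

2·pow2neg-suc : ∀ k → 2 · pow2neg (suc k) ≡ pow2neg k
2·pow2neg-suc k = solve 1 (λ x → con ½ :* x :+ (con ½ :* x :+ con 0ℚ) := x) refl (pow2neg k)
  where open +-*-Solver

pow2neg-antitone : ∀ {m n} → m ℕ.≤ n → pow2neg n ≤ pow2neg m
pow2neg-antitone = suc-mono⇒mono (Flip.isPreorder ℚₚ.≤-isPreorder) pow2neg pow2neg-suc≤
  where
  pow2neg-suc≤ : ∀ k → pow2neg (suc k) ≤ pow2neg k
  pow2neg-suc≤ k = subst (pow2neg (suc k) ≤_) (2·pow2neg-suc k)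
                     (p≤p+q (pow2neg (suc k)) (0≤n·x (0≤pow2neg (suc k)) 1))

2^k·pow2neg[k+a] : ∀ k a → (2 ^ k) · pow2neg (k ℕ.+ a) ≡ pow2neg a
2^k·pow2neg[k+a] zero    a = ℚₚ.+-identityʳ (pow2neg a)
2^k·pow2neg[k+a] (suc k) a = begin
  (2 ℕ.* 2 ^ k) · pow2neg (suc k ℕ.+ a)   ≡⟨ ×-assocˡ _ 2 (2 ^ k) ⟨
  2 · ((2 ^ k) · pow2neg (suc (k ℕ.+ a))) ≡⟨ cong (λ m → 2 · ((2 ^ k) · pow2neg m)) (ℕₚ.+-suc k a) ⟨
  2 · ((2 ^ k) · pow2neg (k ℕ.+ suc a))   ≡⟨ cong (2 ·_) (2^k·pow2neg[k+a] k (suc a)) ⟩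
  2 · pow2neg (suc a)                     ≡⟨ 2·pow2neg-suc a ⟩
  pow2neg a                               ∎
  where open ≡-Reasoning

module _ {a b : ℕ → ℚ} where

  partialSum-cong : (∀ n → a n ≡ b n) → ∀ n → partialSum a n ≡ partialSum b n
  partialSum-cong a≗b zero    = refl
  partialSum-cong a≗b (suc n) = cong₂ _+_ (partialSum-cong a≗b n) (a≗b n)

  partialSum-telescope : (Φ : ℕ → ℚ) → (∀ i → a i + Φ i ≤ b i + Φ (suc i)) →
                         ∀ n → partialSum a n + Φ 0 ≤ partialSum b n + Φ n
  partialSum-telescope Φ step zero    = ℚₚ.≤-refl
  partialSum-telescope Φ step (suc n) = begin
    A + a n + Φ 0       ≡⟨ solve 3 (λ x y z → x :+ y :+ z := x :+ z :+ y) refl A (a n) (Φ 0) ⟩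
    A + Φ 0 + a n       ≤⟨ ℚₚ.+-monoˡ-≤ (a n) (partialSum-telescope Φ step n) ⟩
    B + Φ n + a n       ≡⟨ solve 3 (λ x y z → x :+ y :+ z := x :+ (z :+ y)) refl B (Φ n) (a n) ⟩
    B + (a n + Φ n)     ≤⟨ ℚₚ.+-monoʳ-≤ B (step n) ⟩
    B + (b n + Φ (suc n)) ≡⟨ ℚₚ.+-assoc B (b n) (Φ (suc n)) ⟨
    B + b n + Φ (suc n) ∎
    where
    open ℚₚ.≤-Reasoning
    open +-*-Solver
    A = partialSum a n
    B = partialSum b n

partialSum-mono : ∀ {a} → (∀ n → 0ℚ ≤ a n) → ∀ {m n} → m ℕ.≤ n → partialSum a m ≤ partialSum a n
partialSum-mono {a} 0≤a =
  suc-mono⇒mono ℚₚ.≤-isPreorder (partialSum a) (λ n → p≤p+q (partialSum a n) (0≤a n))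

partialSum-potential-bound : ∀ {a} (Φ : ℕ → ℚ) → (∀ k → a k + Φ (suc k) ≤ Φ k) →
                             ∀ n → partialSum a n + Φ n ≤ Φ 0
partialSum-potential-bound     Φ step zero    = ℚₚ.≤-reflexive (ℚₚ.+-identityˡ (Φ 0))
partialSum-potential-bound {a} Φ step (suc n) = begin
  partialSum a n + a n + Φ (suc n)   ≡⟨ ℚₚ.+-assoc (partialSum a n) (a n) (Φ (suc n)) ⟩
  partialSum a n + (a n + Φ (suc n)) ≤⟨ ℚₚ.+-monoʳ-≤ (partialSum a n) (step n) ⟩
  partialSum a n + Φ n               ≤⟨ partialSum-potential-bound Φ step n ⟩
  Φ 0                                ∎
  where open ℚₚ.≤-Reasoning

fromℤ-suc : ∀ n → fromℤ (ℤ.+ n) + 1ℚ ≡ fromℤ (ℤ.+ suc n)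
fromℤ-suc n = trans (cong (ℚ._/ 1) n*1+1≡1+n) (ℚₚ.normalize-coprime _)
  where
  n*1+1≡1+n : ℤ.+ n ℤ.* ℤ.+ 1 ℤ.+ ℤ.+ 1 ≡ ℤ.+ suc n
  n*1+1≡1+n = trans (cong (ℤ._+ ℤ.+ 1) (ℤₚ.*-identityʳ (ℤ.+ n))) (ℤₚ.+-comm (ℤ.+ n) (ℤ.+ 1))

archimedean : ∀ p → ∃[ n ] p < fromℤ (ℤ.+ n)
archimedean (mkℚ (ℤ.+ m)   d _) = suc m , *<* (subst₂ ℤ._<_
  (sym (ℤₚ.*-identityʳ (ℤ.+ m))) (sym (ℤₚ.pos-* (suc m) (suc d))) (ℤ.+<+ (ℕₚ.m≤m*n (suc m) (suc d))))
archimedean (mkℚ -[1+ m ] d _) = 0 , *<* -<+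

1≤⇒diverges : ∀ {a} → (∀ k → 1ℚ ≤ a k) → Diverges a
1≤⇒diverges {a} 1≤a B with archimedean B
... | n , B<n = n , ℚₚ.<-≤-trans B<n (n≤partialSum n)
  where
  n≤partialSum : ∀ n → fromℤ (ℤ.+ n) ≤ partialSum a n
  n≤partialSum zero    = ℚₚ.≤-refl
  n≤partialSum (suc n) =
    subst (_≤ partialSum a (suc n)) (fromℤ-suc n) (ℚₚ.+-mono-≤ (n≤partialSum n) (1≤a n))

diverges-by-potential : ∀ {a b} (Φ : ℕ → ℚ) (C : ℚ) → 0ℚ ≤ Φ 0 → (∀ i → Φ i ≤ C) →
                        (∀ i → a i + Φ i ≤ b i + Φ (suc i)) → Diverges a → Diverges b
diverges-by-potential {a} {b} Φ C 0≤Φ0 Φ≤C step a-diverges B with a-diverges (B + C)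
... | N , B+C<ΣaN = N , +-cancelʳ-< C (begin-strict
  B + C                   <⟨ B+C<ΣaN ⟩
  partialSum a N          ≤⟨ p≤p+q (partialSum a N) 0≤Φ0 ⟩
  partialSum a N + Φ 0    ≤⟨ partialSum-telescope Φ step N ⟩
  partialSum b N + Φ N    ≤⟨ ℚₚ.+-monoʳ-≤ (partialSum b N) (Φ≤C N) ⟩
  partialSum b N + C      ∎)
  where open ℚₚ.≤-Reasoning

level : ℕ → ℕ
level j = 2 ^ j

blockLength : ℕ → ℕ
blockLength j = 2 ^ level j

blockLength-positive : ∀ j → 0 ℕ.< blockLength j
blockLength-positive j = ℕₚ.m^n>0 2 (level j)

next : ℕ × ℕ → ℕ × ℕ
next (j , o) with suc o <? blockLength j
... | yes _ = j , suc o
... | no  _ = suc j , 0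

position : ℕ → ℕ × ℕ
position zero    = 0 , 0
position (suc n) = next (position n)

block offset : ℕ → ℕ
block  n = proj₁ (position n)
offset n = proj₂ (position n)

g : ℕ → ℕ
g n = level (block n)

offset<blockLength : ∀ n → offset n ℕ.< blockLength (block n)
offset<blockLength zero    = blockLength-positive 0
offset<blockLength (suc n) with suc (offset n) <? blockLength (block n)
... | yes o+1<N = o+1<N
... | no  _     = blockLength-positive (suc (block n))

g-nondecreasing : Nondecreasing g
g-nondecreasing m≤n = ℕₚ.^-monoʳ-≤ 2 (suc-mono⇒mono ℕₚ.≤-isPreorder block block-suc m≤n)
  where
  block-suc : ∀ n → block n ℕ.≤ block (suc n)
  block-suc n with suc (offset n) <? blockLength (block n)
  ... | yes _ = ℕₚ.≤-refl
  ... | no  _ = ℕₚ.n≤1+n (block n)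

next-inside : ∀ {j o} → suc o ℕ.< blockLength j → next (j , o) ≡ (j , suc o)
next-inside {j} {o} o+1<N with suc o <? blockLength j
... | yes _     = refl
... | no  o+1≮N = contradiction o+1<N o+1≮N

next-last : ∀ {j o} → suc o ≡ blockLength j → next (j , o) ≡ (suc j , 0)
next-last {j} {o} o+1≡N with suc o <? blockLength j
... | yes o+1<N = contradiction o+1≡N (ℕₚ.<⇒≢ o+1<N)
... | no  _     = refl

position-+ : ∀ {j o} t k → position t ≡ (j , o) → o ℕ.+ k ℕ.< blockLength j →
             position (t ℕ.+ k) ≡ (j , o ℕ.+ k)
position-+ {j} {o} t zero    pos _ rewrite ℕₚ.+-identityʳ t | ℕₚ.+-identityʳ o = pos
position-+ {j} {o} t (suc k) pos o+k+1<N rewrite ℕₚ.+-suc t k | ℕₚ.+-suc o k =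
  trans (cong next (position-+ t k pos (ℕₚ.<⇒≤ o+k+1<N))) (next-inside o+k+1<N)

position-blockEnd : ∀ {j o} t k → position t ≡ (j , o) → suc (o ℕ.+ k) ≡ blockLength j →
                    position (t ℕ.+ suc k) ≡ (suc j , 0)
position-blockEnd t k pos o+k+1≡N rewrite ℕₚ.+-suc t k =
  trans (cong next (position-+ t k pos (ℕₚ.≤-reflexive o+k+1≡N))) (next-last o+k+1≡N)

blockStart : ∀ j → ∃[ n ] position n ≡ (j , 0)
blockStart zero    = 0 , refl
blockStart (suc j) with blockStart j
... | n , pos = n ℕ.+ suc k , position-blockEnd n k pos (ℕₚ.m+[n∸m]≡n (blockLength-positive j))
  where k = blockLength j ∸ 1

blockwise : (x y : ℕ → ℚ) → ℕ → ℚ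
blockwise x y n with suc (offset n) <? blockLength (block n)
... | yes _ = x (block n)
... | no  _ = x (block n) + y (block n)

blockTotal : (x y : ℕ → ℚ) → ℕ → ℚ
blockTotal x y j = blockLength j · x j + y j

0≤blockwise : ∀ {x y} → (∀ j → 0ℚ ≤ x j) → (∀ j → 0ℚ ≤ y j) → ∀ n → 0ℚ ≤ blockwise x y n
0≤blockwise 0≤x 0≤y n with suc (offset n) <? blockLength (block n)
... | yes _ = 0≤x (block n)
... | no  _ = ℚₚ.+-mono-≤ (0≤x (block n)) (0≤y (block n))

partialSum-blockwise : ∀ x y n → partialSum (blockwise x y) n
                                 ≡ partialSum (blockTotal x y) (block n) + offset n · x (block n)
partialSum-blockwise x y zero    = refl
partialSum-blockwise x y (suc n)
  with suc (offset n) <? blockLength (block n) | partialSum-blockwise x y n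
... | yes _ | ih = begin
  partialSum (blockwise x y) n + x j ≡⟨ cong (_+ x j) ih ⟩
  S j + o · x j + x j                ≡⟨ solve 3 (λ s u v → s :+ u :+ v := s :+ (v :+ u))
                                               refl (S j) (o · x j) (x j) ⟩
  S j + suc o · x j                  ∎
  where
  open ≡-Reasoning
  open +-*-Solver
  j = block n
  o = offset n
  S = partialSum (blockTotal x y)
... | no o+1≮N | ih = begin
  partialSum (blockwise x y) n + (x j + y j) ≡⟨ cong (_+ (x j + y j)) ih ⟩
  S j + o · x j + (x j + y j)                ≡⟨ solve 4 (λ s u v w → s :+ u :+ (v :+ w)
                                                                := s :+ ((v :+ u) :+ w) :+ con 0ℚ)
                                                       refl (S j) (o · x j) (x j) (y j) ⟩
  S j + (suc o · x j + y j) + 0ℚ             ≡⟨ cong (λ m → S j + (m · x j + y j) + 0ℚ) o+1≡N ⟩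
  S (suc j) + 0 · x (suc j)                  ∎
  where
  open ≡-Reasoning
  open +-*-Solver
  j = block n
  o = offset n
  S = partialSum (blockTotal x y)
  o+1≡N : suc o ≡ blockLength j
  o+1≡N = ℕₚ.≤-antisym (offset<blockLength n) (ℕₚ.≮⇒≥ o+1≮N)

partialSum-blockwise-at : ∀ x y n {j o} → position n ≡ (j , o) →
                          partialSum (blockwise x y) n ≡ partialSum (blockTotal x y) j + o · x j
partialSum-blockwise-at x y n pos = trans (partialSum-blockwise x y n)
  (cong (λ p → partialSum (blockTotal x y) (proj₁ p) + proj₂ p · x (proj₁ p)) pos)

pow2neg∘g≗blockwise : ∀ n → pow2neg (g n) ≡ blockwise (pow2neg ∘ level) (λ _ → 0ℚ) n
pow2neg∘g≗blockwise n with suc (offset n) <? blockLength (block n)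
... | yes _ = refl
... | no  _ = sym (ℚₚ.+-identityʳ _)

blockTotal-pow2neg∘level≡1 : ∀ j → blockTotal (pow2neg ∘ level) (λ _ → 0ℚ) j ≡ 1ℚ
blockTotal-pow2neg∘level≡1 j = begin
  blockLength j · pow2neg (level j) + 0ℚ  ≡⟨ ℚₚ.+-identityʳ _ ⟩
  blockLength j · pow2neg (level j)       ≡⟨ cong (λ k → blockLength j · pow2neg k)
                                                  (ℕₚ.+-identityʳ (level j)) ⟨
  blockLength j · pow2neg (level j ℕ.+ 0) ≡⟨ 2^k·pow2neg[k+a] (level j) 0 ⟩
  1ℚ                                      ∎
  where open ≡-Reasoning

g-diverges : Diverges (λ i → pow2neg (g i))
g-diverges B with 1≤⇒diverges (ℚₚ.≤-reflexive ∘ sym ∘ blockTotal-pow2neg∘level≡1) B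
... | J , B<ΣJ with blockStart J
... | n , pos = n , (begin-strict
  B                                  <⟨ B<ΣJ ⟩
  partialSum (blockTotal x y) J      ≡⟨ ℚₚ.+-identityʳ _ ⟨
  partialSum (blockTotal x y) J + 0ℚ ≡⟨ partialSum-blockwise-at x y n pos ⟨
  partialSum (blockwise x y) n       ≡⟨ partialSum-cong pow2neg∘g≗blockwise n ⟨
  partialSum (λ i → pow2neg (g i)) n ∎)
  where
  open ℚₚ.≤-Reasoning
  x = pow2neg ∘ level
  y = λ (_ : ℕ) → 0ℚ

baseWeight : ℕ → ℚ
baseWeight j = pow2neg (j ℕ.+ level j)

bonus : ℕ → ℚ
bonus j = pow2neg (level j)

potential : ℕ → ℚ
potential = partialSum (blockwise baseWeight bonus)

blockPotential : ℕ → ℚ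
blockPotential = partialSum (blockTotal baseWeight bonus)

potential-at : ∀ t {j o} → position t ≡ (j , o) → potential t ≡ blockPotential j + o · baseWeight j
potential-at = partialSum-blockwise-at baseWeight bonus

potential-at-blockStart : ∀ t {j} → position t ≡ (j , 0) → potential t ≡ blockPotential j
potential-at-blockStart t pos = trans (potential-at t pos) (ℚₚ.+-identityʳ _)

0≤baseWeight : ∀ j → 0ℚ ≤ baseWeight j
0≤baseWeight j = 0≤pow2neg (j ℕ.+ level j)

level·baseWeight : ∀ j → level j · baseWeight j ≡ bonus j
level·baseWeight j = 2^k·pow2neg[k+a] j (level j)

blockLength·baseWeight : ∀ j → blockLength j · baseWeight j ≡ pow2neg j
blockLength·baseWeight j = trans (cong (λ k → blockLength j · pow2neg k) (ℕₚ.+-comm j (level j)))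
                                 (2^k·pow2neg[k+a] (level j) j)

potential-mono : ∀ {m n} → m ℕ.≤ n → potential m ≤ potential n
potential-mono = partialSum-mono (0≤blockwise 0≤baseWeight (0≤pow2neg ∘ level))

blockPotential-bounded : ∀ j → blockPotential j ≤ 4 · 1ℚ
blockPotential-bounded j = begin
  blockPotential j                 ≤⟨ p≤p+q (blockPotential j) (0≤n·x (0≤pow2neg j) 4) ⟩
  blockPotential j + 4 · pow2neg j ≤⟨ partialSum-potential-bound (λ k → 4 · pow2neg k) blockTotal≤ j ⟩
  4 · 1ℚ                           ∎
  where
  open ℚₚ.≤-Reasoning
  blockTotal≤ : ∀ k → blockTotal baseWeight bonus k + 4 · pow2neg (suc k) ≤ 4 · pow2neg k
  blockTotal≤ k = begin
    blockLength k · baseWeight k + bonus k + 4 · pow2neg (suc k)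
      ≡⟨ cong (λ z → z + bonus k + 4 · pow2neg (suc k)) (blockLength·baseWeight k) ⟩
    pow2neg k + bonus k + 4 · pow2neg (suc k)
      ≤⟨ ℚₚ.+-monoˡ-≤ _ (ℚₚ.+-monoʳ-≤ (pow2neg k) (pow2neg-antitone (ℕₚ.<⇒≤ (n<2^n k)))) ⟩
    pow2neg k + pow2neg k + 4 · pow2neg (suc k)
      ≡⟨ solve 1 (λ x → x :+ x :+ (h x :+ (h x :+ (h x :+ (h x :+ con 0ℚ))))
                        := x :+ (x :+ (x :+ (x :+ con 0ℚ))))
                 refl (pow2neg k) ⟩
    4 · pow2neg k
      ∎
    where
    open +-*-Solver
    h = λ x → con ½ :* x

potential-inBlock : ∀ t k → offset t ℕ.+ k ℕ.< blockLength (block t) →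
                    potential (t ℕ.+ k) ≡ potential t + k · baseWeight (block t)
potential-inBlock t k o+k<N = begin
  potential (t ℕ.+ k)   ≡⟨ potential-at (t ℕ.+ k) (position-+ t k refl o+k<N) ⟩
  P + (o ℕ.+ k) · c     ≡⟨ cong (P +_) (×-homo-+ c o k) ⟩
  P + (o · c + k · c)   ≡⟨ ℚₚ.+-assoc P (o · c) (k · c) ⟨
  P + o · c + k · c     ≡⟨ cong (_+ k · c) (potential-at t refl) ⟨
  potential t + k · c   ∎
  where
  open ≡-Reasoning
  P = blockPotential (block t)
  o = offset t
  c = baseWeight (block t)

potential+bonus≤blockPotential : ∀ n → potential n + bonus (block n) ≤ blockPotential (suc (block n))
potential+bonus≤blockPotential n = begin
  potential n + bonus j           ≡⟨ cong (_+ bonus j) (potential-at n refl) ⟩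
  P + offset n · c + bonus j      ≤⟨ ℚₚ.+-monoˡ-≤ (bonus j) (ℚₚ.+-monoʳ-≤ P offset·c≤N·c) ⟩
  P + blockLength j · c + bonus j ≡⟨ ℚₚ.+-assoc P (blockLength j · c) (bonus j) ⟩
  blockPotential (suc j)          ∎
  where
  open ℚₚ.≤-Reasoning
  j = block n
  P = blockPotential j
  c = baseWeight j
  offset·c≤N·c : offset n · c ≤ blockLength j · c
  offset·c≤N·c = ·-monoˡ-≤ (0≤baseWeight j) (ℕₚ.<⇒≤ (offset<blockLength n))

potential-bounded : ∀ n → potential n ≤ 4 · 1ℚ
potential-bounded n = begin
  potential n                    ≤⟨ p≤p+q (potential n) (0≤pow2neg (g n)) ⟩
  potential n + bonus (block n)  ≤⟨ potential+bonus≤blockPotential n ⟩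
  blockPotential (suc (block n)) ≤⟨ blockPotential-bounded (suc (block n)) ⟩
  4 · 1ℚ                         ∎
  where open ℚₚ.≤-Reasoning

-- Either the next g t entries all lie in the current block, or the last entry of the block,
-- which carries the bonus, comes first.
potential-gains-bonus : ∀ t → ∃[ e ] e ℕ.≤ g t × potential t + pow2neg (g t) ≤ potential (t ℕ.+ e)
potential-gains-bonus t with offset t ℕ.+ g t <? blockLength (block t)
... | yes o+L<N = g t , ℕₚ.≤-refl , ℚₚ.≤-reflexive (begin
  potential t + bonus j                ≡⟨ cong (potential t +_) (level·baseWeight j) ⟨
  potential t + level j · baseWeight j ≡⟨ potential-inBlock t (level j) o+L<N ⟨
  potential (t ℕ.+ level j)            ∎)
  where
  open ≡-Reasoning
  j = block t
... | no o+L≮N = suc k , k<L , (begin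
  potential t + bonus j   ≤⟨ potential+bonus≤blockPotential t ⟩
  blockPotential (suc j)  ≡⟨ potential-at-blockStart (t ℕ.+ suc k) (position-blockEnd t k refl o+k+1≡N) ⟨
  potential (t ℕ.+ suc k) ∎)
  where
  open ℚₚ.≤-Reasoning
  j = block t
  o = offset t
  k = blockLength j ∸ suc o
  o+k+1≡N : suc (o ℕ.+ k) ≡ blockLength j
  o+k+1≡N = ℕₚ.m+[n∸m]≡n (offset<blockLength t)
  k<L : suc k ℕ.≤ level j
  k<L = ℕₚ.+-cancelˡ-≤ o (suc k) (level j)
          (subst (ℕ._≤ o ℕ.+ level j) (sym (trans (ℕₚ.+-suc o k) o+k+1≡N)) (ℕₚ.≮⇒≥ o+L≮N))

potential-step : ∀ {m n} → m ℕ.≤ n → pow2neg (g m) + potential m ≤ pow2neg (n ∸ m) + potential n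
potential-step {m} {n} m≤n with n ∸ m ℕ.≤? g m | potential-gains-bonus m
... | yes n-m≤gm | _ = ℚₚ.+-mono-≤ (pow2neg-antitone n-m≤gm) (potential-mono m≤n)
... | no  n-m≰gm | e , e≤gm , gain = begin
  pow2neg (g m) + potential m   ≡⟨ ℚₚ.+-comm (pow2neg (g m)) (potential m) ⟩
  potential m + pow2neg (g m)   ≤⟨ gain ⟩
  potential (m ℕ.+ e)           ≤⟨ potential-mono m+e≤n ⟩
  potential n                   ≤⟨ p≤q+p (potential n) (0≤pow2neg (n ∸ m)) ⟩
  pow2neg (n ∸ m) + potential n ∎
  where
  open ℚₚ.≤-Reasoning
  m+e≤n : m ℕ.+ e ℕ.≤ n
  m+e≤n = subst (m ℕ.+ e ℕ.≤_) (ℕₚ.m+[n∸m]≡n m≤n)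
            (ℕₚ.+-monoʳ-≤ m (ℕₚ.≤-trans e≤gm (ℕₚ.<⇒≤ (ℕₚ.≰⇒> n-m≰gm))))

proposition3p4 : ∃[ g ] (Nondecreasing g × Diverges (λ i → pow2neg (g i))
                   × (∀ (t : ℕ → ℕ) → StrictlyIncreasing t → Positive t
                      → Diverges (λ i → pow2neg (g (t i)))
                      → Diverges (λ i → pow2neg (t (suc i) ∸ t i))))
proposition3p4 = g , g-nondecreasing , g-diverges , λ t t-increasing _ →
  diverges-by-potential (potential ∘ t) (4 · 1ℚ) (potential-mono {0} {t 0} ℕ.z≤n) (potential-bounded ∘ t)
                        (λ i → potential-step (ℕₚ.<⇒≤ (t-increasing i)))
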